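{- Let $H(n,k)=\max_{B}|T(n,k,B)|$, the maximum over all injective functions $B:\{1,\dots,k\}\to 2^{Q}$ with $|Q|=n$. Then $H(n,k)=2^{O(k\lg k)}$ for $k=O(n)$, and $H(n,k)=2^{O(n\lg n)}$ for $k=\omega(n)$.
   Context: Let $Q$ be a set of $n$ states, $I=\{1,\dots,k\}$, and $B:I\to 2^{Q}$ injective. For a finite sequence $\alpha$ over $I$, let $U(\alpha)=\bigcup_{i}B(\alpha[i])$, $\mathrm{Cover}(\alpha)=\{j\in I: B(j)\subseteq U(\alpha)\}$, and define $\mathrm{Mini}(\alpha)\subseteq I$ by: $j\in\mathrm{Mini}(\alpha)$ iff $j\notin\mathrm{Cover}(\alpha)$ and for every $j'\in I\setminus\mathrm{Cover}(\alpha)$, $j'\ne j$ implies $B(j')\cup U(\alpha)\not\subset B(j)\cup U(\alpha)$ (strict inclusion), and $j'<j$ implies $B(j')\cup U(\alpha)\ne B(j)\cup U(\alpha)$. The Increasing Tree of Sets $T(n,k,B)$ is the rooted tree whose nodes are the empty sequence (root) and all nonempty finite sequences $\alpha$ over $I$ with $\alpha[i]\in\mathrm{Mini}(\alpha[1..i-1])$ for all $i\in[1,|\alpha|]$, the parent of a nonempty $\alpha$ being $\alpha$ with its last entry deleted; $|T(n,k,B)|$ denotes the number of non-root nodes. -}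

module Defs where

open import Data.Nat using (ℕ; zero; suc; _+_; _*_; _^_; _≤_)
open import Data.Nat.Logarithm using (⌈log₂_⌉)
open import Data.Fin using (Fin) renaming (_<_ to _<ᶠ_)
open import Data.Fin.Subset using (Subset; ⊥; _∪_; _⊆_; _⊂_)
open import Data.List using (List; []; _∷_; foldr; length; reverse)
open import Data.List.Relation.Unary.All using (All)
open import Data.List.Relation.Unary.Unique.Propositional using (Unique)
open import Data.Product using (_×_)
open import Data.Unit using (⊤)
open import Function.Definitions using (Injective)
open import Relation.Binary.PropositionalEquality using (_≡_; _≢_)
open import Relation.Nullary using (¬_)

-- Q = Fin n, I = Fin k (0-indexed; index order as on {1..k}).
-- Assignment B : I → 2^Q.
Assignment : ℕ → ℕ → Set
Assignment n k = Fin k → Subset n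

U : ∀ {n k} → Assignment n k → List (Fin k) → Subset n
U B α = foldr (λ j acc → B j ∪ acc) ⊥ α

InCover : ∀ {n k} → Assignment n k → List (Fin k) → Fin k → Set
InCover B α j = B j ⊆ U B α

InMini : ∀ {n k} → Assignment n k → List (Fin k) → Fin k → Set
InMini B α j =
  ¬ InCover B α j ×
  (∀ j' → ¬ InCover B α j' →
     (j' ≢ j → ¬ ((B j' ∪ U B α) ⊂ (B j ∪ U B α))) ×
     (j' <ᶠ j → (B j' ∪ U B α) ≢ (B j ∪ U B α)))

-- Validity of a sequence given in REVERSED order (last entry first):
-- (j ∷ r) is valid iff r is valid and j ∈ Mini(reverse r).
ValidRev : ∀ {n k} → Assignment n k → List (Fin k) → Set
ValidRev B [] = ⊤
ValidRev B (j ∷ r) = ValidRev B r × InMini B (reverse r) j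

-- α (in natural order α[1], α[2], ...) is a non-root node of T(n,k,B)
IsNode : ∀ {n k} → Assignment n k → List (Fin k) → Set
IsNode B α = α ≢ [] × ValidRev B (reverse α)

-- |T(n,k,B)| ≤ m : every duplicate-free list of non-root nodes has length ≤ m
SizeT≤ : ∀ {n k} → Assignment n k → ℕ → Set
SizeT≤ B m = ∀ (xs : List (List (Fin _))) → Unique xs → All (IsNode B) xs → length xs ≤ m

H≤ : ℕ → ℕ → ℕ → Set
H≤ n k m = ∀ (B : Assignment n k) → Injective _≡_ _≡_ B → SizeT≤ B m

lg : ℕ → ℕ
lg x = ⌈log₂ x ⌉

-- Every entry of a node is outside Cover of its prefix, so a node repeats no index
-- (at most k entries) and each entry adds a new state to U (at most n entries).
-- For k = O(n) count the duplicate-free sequences: at most k (k+1)^(k-1) of them.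
-- For k = ω(n) record, for every state q, the step at which q entered U. This code
-- determines the node: by induction the prefix is fixed, and the last entry j is then
-- fixed by B(j) ∪ U(prefix), because the index-order clause of Mini makes the element
-- of Mini(α) producing a given union unique. There are at most (n+2)^(n+1) codes.
module Submission where

open import Defs
open import Data.Nat using (ℕ; zero; suc; pred; _+_; _*_; _^_; _≤_; _<_; z≤n; s≤s; z<s; ⌈_/2⌉; _≟_)
open import Data.Nat.Properties
open import Data.Nat.Induction using (<-wellFounded)
open import Data.Nat.Logarithm using (⌈log₂_⌉)
open import Data.Nat.Logarithm.Core using (⌈log2⌉)
open import Data.Nat.Tactic.RingSolver using (solve-∀)
open import Data.Fin using (Fin) renaming (zero to fzero; suc to fsuc)
import Data.Fin.Properties as Fin
open import Data.Fin.Subset using (Subset; _∪_; _⊆_; _⊂_; ∣_∣) renaming (_∈_ to _∈ₛ_; _∉_ to _∉ₛ_)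
open import Data.Fin.Subset.Properties
  using (_∈?_; ∉⊥; ∣p∣≤n; p⊂q⇒∣p∣<∣q∣; p⊆p∪q; q⊆p∪q; x∈p∪q⁻; ⊆-trans; ⊆-antisym; ∪-assoc; ∪-comm)
open import Data.List using (List; []; _∷_; _++_; _∷ʳ_; [_]; length; map; filter; reverse; tabulate; allFin; upTo; cartesianProductWith)
open import Data.List.Properties
  using (length-++; length-map; length-reverse; length-tabulate; length-upTo; filter-notAll; unfold-reverse; reverse-injective; ∷-injective; ≡-dec)
open import Data.List.Membership.Propositional using (_∈_)
open import Data.List.Membership.Propositional.Properties
  using (∈-map⁻; ∈-filter⁺; ∈-allFin; ∈-upTo⁺; ∈-cartesianProductWith⁺)
open import Data.List.Relation.Binary.Subset.Propositional using () renaming (_⊆_ to _⊆ₗ_)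
open import Data.List.Relation.Unary.Any as Any using (here; there)
open import Data.List.Relation.Unary.Any.Properties using (reverse⁺)
open import Data.List.Relation.Unary.All as All using (All; []; _∷_)
open import Data.List.Relation.Unary.All.Properties using (tabulate⁺) renaming (map⁺ to All-map⁺)
open import Data.List.Relation.Unary.AllPairs using ([]; _∷_)
open import Data.List.Relation.Unary.Unique.Propositional using (Unique)
open import Data.Product using (_×_; _,_; ∃-syntax; proj₁; proj₂)
open import Data.Sum using (inj₁; inj₂)
open import Function using (_∘_)
open import Induction.WellFounded using (Acc; acc)
open import Relation.Binary.Definitions using (DecidableEquality; tri<; tri≈; tri>)
open import Relation.Binary.PropositionalEquality using (_≡_; _≢_; refl; sym; trans; cong; cong₂; subst; module ≡-Reasoning)
open import Relation.Nullary using (¬_; yes; no; ¬?; contradiction)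
open import Relation.Nullary.Decidable using (_×-dec_; decidable-stable)

module _ {A : Set} (_≟ₐ_ : DecidableEquality A) where

  Unique-⊆⇒length≤ : ∀ {xs ys : List A} → Unique xs → xs ⊆ₗ ys → length xs ≤ length ys
  Unique-⊆⇒length≤ {[]}     _            _       = z≤n
  Unique-⊆⇒length≤ {x ∷ xs} {ys} (x∉xs ∷ !xs) x∷xs⊆ys = begin-strict
    length xs                        ≤⟨ Unique-⊆⇒length≤ !xs xs⊆ys-x ⟩
    length (filter (¬? ∘ (x ≟ₐ_)) ys) <⟨ filter-notAll _ ys (Any.map (λ x≡y x≢y → x≢y x≡y) (x∷xs⊆ys (here refl))) ⟩
    length ys                        ∎
    where
    open ≤-Reasoning
    xs⊆ys-x : xs ⊆ₗ filter (¬? ∘ (x ≟ₐ_)) ys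
    xs⊆ys-x y∈xs = ∈-filter⁺ (¬? ∘ (x ≟ₐ_)) (x∷xs⊆ys (there y∈xs)) (All.lookup x∉xs y∈xs)

module _ {A C : Set} (_≟ᶜ_ : DecidableEquality C) {P : A → Set} {f : A → C} {cs : List C}
         (f-injective : ∀ {a b} → P a → P b → f a ≡ f b → a ≡ b)
         (f∈cs : ∀ {a} → P a → f a ∈ cs) where

  Unique-map⁺ : ∀ {xs} → Unique xs → All P xs → Unique (map f xs)
  Unique-map⁺ []           []         = []
  Unique-map⁺ (x∉xs ∷ !xs) (px ∷ pxs) =
    All-map⁺ (All.zipWith (λ (x≢y , py) fx≡fy → x≢y (f-injective px py fx≡fy)) (x∉xs , pxs))
      ∷ Unique-map⁺ !xs pxs

  Unique-All⇒length≤ : ∀ {xs} → Unique xs → All P xs → length xs ≤ length cs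
  Unique-All⇒length≤ {xs} !xs pxs = begin
    length xs         ≡⟨ length-map f xs ⟨
    length (map f xs) ≤⟨ Unique-⊆⇒length≤ _≟ᶜ_ (Unique-map⁺ !xs pxs) fxs⊆cs ⟩
    length cs         ∎
    where
    open ≤-Reasoning
    fxs⊆cs : map f xs ⊆ₗ cs
    fxs⊆cs c∈ with _ , a∈xs , refl ← ∈-map⁻ f c∈ = f∈cs (All.lookup pxs a∈xs)

length-cartesianProductWith : ∀ {A B C : Set} (f : A → B → C) xs ys →
  length (cartesianProductWith f xs ys) ≡ length xs * length ys
length-cartesianProductWith f []       ys = refl
length-cartesianProductWith f (x ∷ xs) ys = begin
  length (map (f x) ys ++ cartesianProductWith f xs ys)          ≡⟨ length-++ (map (f x) ys) ⟩
  length (map (f x) ys) + length (cartesianProductWith f xs ys) ≡⟨ cong₂ _+_ (length-map (f x) ys) (length-cartesianProductWith f xs ys) ⟩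
  length ys + length xs * length ys                              ∎
  where open ≡-Reasoning

module _ {A : Set} (xs : List A) where

  listsUpTo : ℕ → List (List A)
  listsUpTo zero    = [ [] ]
  listsUpTo (suc m) = [] ∷ cartesianProductWith _∷_ xs (listsUpTo m)

  ∈-listsUpTo : ∀ {m ys} → length ys ≤ m → All (_∈ xs) ys → ys ∈ listsUpTo m
  ∈-listsUpTo {zero}  {[]}     _         _          = here refl
  ∈-listsUpTo {suc m} {[]}     _         _          = here refl
  ∈-listsUpTo {suc m} {y ∷ ys} (s≤s ∣ys∣≤m) (y∈ ∷ ys∈) =
    there (∈-cartesianProductWith⁺ _∷_ y∈ (∈-listsUpTo ∣ys∣≤m ys∈))

  length-listsUpTo≤ : ∀ m → length (listsUpTo m) ≤ suc (length xs) ^ m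
  length-listsUpTo≤ zero    = ≤-refl
  length-listsUpTo≤ (suc m) = begin
    suc (length (cartesianProductWith _∷_ xs (listsUpTo m))) ≡⟨ cong suc (length-cartesianProductWith _∷_ xs (listsUpTo m)) ⟩
    suc (length xs * length (listsUpTo m))                   ≤⟨ +-mono-≤ (m^n>0 (suc (length xs)) m) (*-monoʳ-≤ (length xs) (length-listsUpTo≤ m)) ⟩
    suc (length xs) ^ suc m                                  ∎
    where open ≤-Reasoning

n≤2^⌈log2⌉n : ∀ n (rec : Acc _<_ n) → n ≤ 2 ^ ⌈log2⌉ n rec
n≤2^⌈log2⌉n zero          _        = z≤n
n≤2^⌈log2⌉n (suc zero)    _        = ≤-refl
n≤2^⌈log2⌉n (suc (suc n)) (acc rs) = begin
  2 + n                           ≤⟨ +-monoʳ-≤ 2 n≤⌈n/2⌉+⌈n/2⌉ ⟩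
  2 + (⌈ n /2⌉ + ⌈ n /2⌉)          ≡⟨ 2+[m+m]≡2*[1+m] ⌈ n /2⌉ ⟩
  2 * suc ⌈ n /2⌉                  ≤⟨ *-monoʳ-≤ 2 (n≤2^⌈log2⌉n (suc ⌈ n /2⌉) _) ⟩
  2 * 2 ^ ⌈log2⌉ (suc ⌈ n /2⌉) _   ∎
  where
  open ≤-Reasoning
  n≤⌈n/2⌉+⌈n/2⌉ : n ≤ ⌈ n /2⌉ + ⌈ n /2⌉
  n≤⌈n/2⌉+⌈n/2⌉ = ≤-trans (≤-reflexive (sym (⌊n/2⌋+⌈n/2⌉≡n n))) (+-monoˡ-≤ ⌈ n /2⌉ (⌊n/2⌋≤⌈n/2⌉ n))
  2+[m+m]≡2*[1+m] : ∀ m → 2 + (m + m) ≡ 2 * suc m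
  2+[m+m]≡2*[1+m] = solve-∀

n≤2^⌈log₂n⌉ : ∀ n → n ≤ 2 ^ ⌈log₂ n ⌉
n≤2^⌈log₂n⌉ n = n≤2^⌈log2⌉n n (<-wellFounded n)

[m*m]^e≤2^[[lg[m]+lg[m]]*e] : ∀ m e → (m * m) ^ e ≤ 2 ^ ((lg m + lg m) * e)
[m*m]^e≤2^[[lg[m]+lg[m]]*e] m e = begin
  (m * m) ^ e                  ≤⟨ ^-monoˡ-≤ e (*-mono-≤ (n≤2^⌈log₂n⌉ m) (n≤2^⌈log₂n⌉ m)) ⟩
  (2 ^ lg m * 2 ^ lg m) ^ e    ≡⟨ cong (_^ e) (^-distribˡ-+-* 2 (lg m) (lg m)) ⟨
  (2 ^ (lg m + lg m)) ^ e      ≡⟨ ^-*-assoc 2 (lg m + lg m) e ⟩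
  2 ^ ((lg m + lg m) * e)      ∎
  where open ≤-Reasoning

m+m≤m*m : ∀ {m} → 2 ≤ m → m + m ≤ m * m
m+m≤m*m {m} 2≤m = ≤-trans (≤-reflexive (m+m≡2*m m)) (*-monoˡ-≤ m 2≤m)
  where
  m+m≡2*m : ∀ m → m + m ≡ 2 * m
  m+m≡2*m = solve-∀

k*[1+k]^[k-1]≤2^[2*[k*lgk]] : ∀ k → k * suc k ^ pred k ≤ 2 ^ (2 * (k * lg k))
k*[1+k]^[k-1]≤2^[2*[k*lgk]] zero       = z≤n
k*[1+k]^[k-1]≤2^[2*[k*lgk]] (suc zero) = ≤-refl
k*[1+k]^[k-1]≤2^[2*[k*lgk]] k@(suc (suc _)) = begin
  k * suc k ^ pred k         ≤⟨ *-monoˡ-≤ (suc k ^ pred k) (n≤1+n k) ⟩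
  suc k ^ k                  ≤⟨ ^-monoˡ-≤ k (≤-trans (m<m+n k z<s) (m+m≤m*m (s≤s (s≤s z≤n)))) ⟩
  (k * k) ^ k                ≤⟨ [m*m]^e≤2^[[lg[m]+lg[m]]*e] k k ⟩
  2 ^ ((lg k + lg k) * k)    ≡⟨ cong (2 ^_) ([l+l]*k≡2*[k*l] (lg k) k) ⟩
  2 ^ (2 * (k * lg k))       ∎
  where
  open ≤-Reasoning
  [l+l]*k≡2*[k*l] : ∀ l k → (l + l) * k ≡ 2 * (k * l)
  [l+l]*k≡2*[k*l] = solve-∀

[2+n]^[1+n]≤2^[3*[n*lgn]] : ∀ {n} → 2 ≤ n → (2 + n) ^ suc n ≤ 2 ^ (3 * (n * lg n))
[2+n]^[1+n]≤2^[3*[n*lgn]] {n} 2≤n = begin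
  (2 + n) ^ suc n                ≤⟨ ^-monoˡ-≤ (suc n) (≤-trans (+-monoˡ-≤ n 2≤n) (m+m≤m*m 2≤n)) ⟩
  (n * n) ^ suc n                ≤⟨ [m*m]^e≤2^[[lg[m]+lg[m]]*e] n (suc n) ⟩
  2 ^ ((lg n + lg n) * suc n)    ≤⟨ ^-monoʳ-≤ 2 exponent≤ ⟩
  2 ^ (3 * (n * lg n))           ∎
  where
  open ≤-Reasoning
  [l+l]*[1+n]≡2*l+2*[n*l] : ∀ l n → (l + l) * suc n ≡ 2 * l + 2 * (n * l)
  [l+l]*[1+n]≡2*l+2*[n*l] = solve-∀
  3*[n*l]≡n*l+2*[n*l] : ∀ l n → 3 * (n * l) ≡ n * l + 2 * (n * l)
  3*[n*l]≡n*l+2*[n*l] = solve-∀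
  exponent≤ : (lg n + lg n) * suc n ≤ 3 * (n * lg n)
  exponent≤ = begin
    (lg n + lg n) * suc n        ≡⟨ [l+l]*[1+n]≡2*l+2*[n*l] (lg n) n ⟩
    2 * lg n + 2 * (n * lg n)    ≤⟨ +-monoˡ-≤ (2 * (n * lg n)) (*-monoˡ-≤ (lg n) 2≤n) ⟩
    n * lg n + 2 * (n * lg n)    ≡⟨ 3*[n*l]≡n*l+2*[n*l] (lg n) n ⟨
    3 * (n * lg n)               ∎

⊈⇒∃∉ : ∀ {n} {p q : Subset n} → ¬ p ⊆ q → ∃[ x ] (x ∈ₛ p × x ∉ₛ q)
⊈⇒∃∉ {p = p} {q} p⊈q with Fin.any? (λ x → (x ∈? p) ×-dec ¬? (x ∈? q))
... | yes x∈p-q = x∈p-q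
... | no  p-q≡∅ = contradiction (λ {x} x∈p → decidable-stable (x ∈? q) (λ x∉q → p-q≡∅ (x , x∈p , x∉q))) p⊈q

⊈⇒⊂∪ : ∀ {n} {p q : Subset n} → ¬ p ⊆ q → q ⊂ p ∪ q
⊈⇒⊂∪ {p = p} {q} p⊈q with x , x∈p , x∉q ← ⊈⇒∃∉ p⊈q = q⊆p∪q p q , x , p⊆p∪q q x∈p , x∉q

length-allFin : ∀ k → length (allFin k) ≡ k
length-allFin k = length-tabulate (λ i → i)

tabulate-injective : ∀ {A : Set} {m} {f g : Fin m → A} → tabulate f ≡ tabulate g → ∀ i → f i ≡ g i
tabulate-injective {m = suc m} eq fzero    = proj₁ (∷-injective eq)
tabulate-injective {m = suc m} eq (fsuc i) = tabulate-injective (proj₂ (∷-injective eq)) i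

zeroAt : ℕ → ℕ → ℕ
zeroAt m v with v ≟ m
... | yes _ = 0
... | no  _ = v

zeroAt-self : ∀ m → zeroAt m m ≡ 0
zeroAt-self m with m ≟ m
... | yes _   = refl
... | no  m≢m = contradiction refl m≢m

zeroAt-< : ∀ {m v} → v < m → zeroAt m v ≡ v
zeroAt-< {m} {v} v<m with v ≟ m
... | yes v≡m = contradiction v≡m (<⇒≢ v<m)
... | no  _   = refl

module _ {n k : ℕ} (B : Assignment n k) where

  U-∷ʳ : ∀ α j → U B (α ∷ʳ j) ≡ B j ∪ U B α
  U-∷ʳ []      j = refl
  U-∷ʳ (i ∷ α) j = begin
    B i ∪ U B (α ∷ʳ j)       ≡⟨ cong (B i ∪_) (U-∷ʳ α j) ⟩
    B i ∪ (B j ∪ U B α)      ≡⟨ ∪-assoc (B i) (B j) (U B α) ⟨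
    (B i ∪ B j) ∪ U B α      ≡⟨ cong (_∪ U B α) (∪-comm (B i) (B j)) ⟩
    (B j ∪ B i) ∪ U B α      ≡⟨ ∪-assoc (B j) (B i) (U B α) ⟩
    B j ∪ (B i ∪ U B α)      ∎
    where open ≡-Reasoning

  ∈⇒⊆U : ∀ {j α} → j ∈ α → B j ⊆ U B α
  ∈⇒⊆U {α = i ∷ α} (here refl) = p⊆p∪q (U B α)
  ∈⇒⊆U {α = i ∷ α} (there j∈α) = ⊆-trans (∈⇒⊆U j∈α) (q⊆p∪q (B i) (U B α))

  Mini-unique : ∀ {α i j} → InMini B α i → InMini B α j → B i ∪ U B α ≡ B j ∪ U B α → i ≡ j
  Mini-unique {i = i} {j} (i∉Cover , i-minimal) (j∉Cover , j-minimal) eq with Fin.<-cmp i j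
  ... | tri< i<j _ _ = contradiction eq (proj₂ (j-minimal i i∉Cover) i<j)
  ... | tri≈ _ i≡j _ = i≡j
  ... | tri> _ _ j<i = contradiction (sym eq) (proj₂ (i-minimal j j∉Cover) j<i)

  -- Nodes are handled through their reversals r, the form in which ValidRev defines them.
  covered : List (Fin k) → Subset n
  covered r = U B (reverse r)

  covered-∷ : ∀ j r → covered (j ∷ r) ≡ B j ∪ covered r
  covered-∷ j r = trans (cong (U B) (unfold-reverse j r)) (U-∷ʳ (reverse r) j)

  ValidRev⇒Unique : ∀ {r} → ValidRev B r → Unique r
  ValidRev⇒Unique {[]}    _                     = []
  ValidRev⇒Unique {j ∷ r} (valid , j∉Cover , _) =
    All.tabulate (λ { i∈r refl → j∉Cover (∈⇒⊆U (reverse⁺ i∈r)) }) ∷ ValidRev⇒Unique valid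

  ValidRev⇒length≤∣covered∣ : ∀ {r} → ValidRev B r → length r ≤ ∣ covered r ∣
  ValidRev⇒length≤∣covered∣ {[]}    _                     = z≤n
  ValidRev⇒length≤∣covered∣ {j ∷ r} (valid , j∉Cover , _) = begin-strict
    length r                ≤⟨ ValidRev⇒length≤∣covered∣ valid ⟩
    ∣ covered r ∣            <⟨ p⊂q⇒∣p∣<∣q∣ (⊈⇒⊂∪ j∉Cover) ⟩
    ∣ B j ∪ covered r ∣      ≡⟨ cong ∣_∣ (covered-∷ j r) ⟨
    ∣ covered (j ∷ r) ∣      ∎
    where open ≤-Reasoning

  ∈covered-∷ : ∀ j r {q} → q ∈ₛ B j ∪ covered r → q ∈ₛ covered (j ∷ r)
  ∈covered-∷ j r {q} = subst (q ∈ₛ_) (sym (covered-∷ j r))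

  -- The step at which q entered `covered`, counted from 1; 0 if it never did.
  coverStep : List (Fin k) → Fin n → ℕ
  coverStep []      q = 0
  coverStep (j ∷ r) q with q ∈? covered r | q ∈? B j
  ... | yes _ | _     = coverStep r q
  ... | no  _ | yes _ = length (j ∷ r)
  ... | no  _ | no  _ = 0

  coverStep≤length : ∀ r q → coverStep r q ≤ length r
  coverStep≤length []      q = z≤n
  coverStep≤length (j ∷ r) q with q ∈? covered r | q ∈? B j
  ... | yes _ | _     = m≤n⇒m≤1+n (coverStep≤length r q)
  ... | no  _ | yes _ = ≤-refl
  ... | no  _ | no  _ = z≤n

  coverStep≢0⇒∈ : ∀ r {q} → coverStep r q ≢ 0 → q ∈ₛ covered r
  coverStep≢0⇒∈ []          step≢0 = contradiction refl step≢0
  coverStep≢0⇒∈ (j ∷ r) {q} step≢0 with q ∈? covered r | q ∈? B j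
  ... | yes q∈r | _       = ∈covered-∷ j r (q⊆p∪q (B j) (covered r) q∈r)
  ... | no  _   | yes q∈j = ∈covered-∷ j r (p⊆p∪q (covered r) q∈j)
  ... | no  _   | no  _   = contradiction refl step≢0

  ∉⇒coverStep≡0 : ∀ r {q} → q ∉ₛ covered r → coverStep r q ≡ 0
  ∉⇒coverStep≡0 r {q} q∉ = decidable-stable (coverStep r q ≟ 0) (q∉ ∘ coverStep≢0⇒∈ r)

  ∈⇒coverStep≢0 : ∀ r {q} → q ∈ₛ covered r → coverStep r q ≢ 0
  ∈⇒coverStep≢0 []          q∈ = contradiction q∈ ∉⊥
  ∈⇒coverStep≢0 (j ∷ r) {q} q∈ with q ∈? covered r | q ∈? B j
  ... | yes q∈r | _       = ∈⇒coverStep≢0 r q∈r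
  ... | no  _   | yes _   = λ ()
  ... | no  q∉r | no  q∉j with x∈p∪q⁻ (B j) (covered r) (subst (q ∈ₛ_) (covered-∷ j r) q∈)
  ...   | inj₁ q∈j = contradiction q∈j q∉j
  ...   | inj₂ q∈r = contradiction q∈r q∉r

  coverStep⇒covered≡ : ∀ r s → (∀ q → coverStep r q ≡ coverStep s q) → covered r ≡ covered s
  coverStep⇒covered≡ r s same = ⊆-antisym (transfer r s same) (transfer s r (sym ∘ same))
    where
    transfer : ∀ r s → (∀ q → coverStep r q ≡ coverStep s q) → covered r ⊆ covered s
    transfer r s same {q} q∈ = coverStep≢0⇒∈ s (λ s≡0 → ∈⇒coverStep≢0 r q∈ (trans (same q) s≡0))

  coverStep-∷ : ∀ j r q → coverStep r q ≡ zeroAt (length (j ∷ r)) (coverStep (j ∷ r) q)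
  coverStep-∷ j r q with q ∈? covered r | q ∈? B j
  ... | yes _   | _     = sym (zeroAt-< (s≤s (coverStep≤length r q)))
  ... | no  q∉r | yes _ = trans (∉⇒coverStep≡0 r q∉r) (sym (zeroAt-self (length (j ∷ r))))
  ... | no  q∉r | no  _ = trans (∉⇒coverStep≡0 r q∉r) (sym (zeroAt-< {length (j ∷ r)} z<s))

  coverStep-injective : ∀ {r s} → ValidRev B r → ValidRev B s → length r ≡ length s →
                        (∀ q → coverStep r q ≡ coverStep s q) → r ≡ s
  coverStep-injective {[]}    {[]}    _ _ _ _ = refl
  coverStep-injective {j ∷ r} {i ∷ s} (valid-r , j∈Mini) (valid-s , i∈Mini) |j∷r|≡|i∷s| same
    = cong₂ _∷_ (Mini-unique {α = reverse r} j∈Mini (subst (λ t → InMini B (reverse t) i) (sym r≡s) i∈Mini) unions≡) r≡s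
    where
    open ≡-Reasoning
    sameOnTails : ∀ q → coverStep r q ≡ coverStep s q
    sameOnTails q = begin
      coverStep r q                                     ≡⟨ coverStep-∷ j r q ⟩
      zeroAt (length (j ∷ r)) (coverStep (j ∷ r) q)     ≡⟨ cong₂ zeroAt |j∷r|≡|i∷s| (same q) ⟩
      zeroAt (length (i ∷ s)) (coverStep (i ∷ s) q)     ≡⟨ coverStep-∷ i s q ⟨
      coverStep s q                                     ∎
    r≡s : r ≡ s
    r≡s = coverStep-injective valid-r valid-s (suc-injective |j∷r|≡|i∷s|) sameOnTails
    unions≡ : B j ∪ covered r ≡ B i ∪ covered r
    unions≡ = begin
      B j ∪ covered r    ≡⟨ covered-∷ j r ⟨
      covered (j ∷ r)    ≡⟨ coverStep⇒covered≡ (j ∷ r) (i ∷ s) same ⟩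
      covered (i ∷ s)    ≡⟨ covered-∷ i s ⟩
      B i ∪ covered s    ≡⟨ cong (λ t → B i ∪ covered t) r≡s ⟨
      B i ∪ covered r    ∎

  ValidRev⇒length≤k : ∀ r → ValidRev B r → length r ≤ k
  ValidRev⇒length≤k r valid = begin
    length r           ≤⟨ Unique-⊆⇒length≤ Fin._≟_ (ValidRev⇒Unique valid) (λ {i} _ → ∈-allFin i) ⟩
    length (allFin k)  ≡⟨ length-allFin k ⟩
    k                  ∎
    where open ≤-Reasoning

  ValidRev⇒length≤n : ∀ r → ValidRev B r → length r ≤ n
  ValidRev⇒length≤n r valid = ≤-trans (ValidRev⇒length≤∣covered∣ valid) (∣p∣≤n (covered r))

  SizeT≤k*[1+k]^[k-1] : SizeT≤ B (k * suc k ^ pred k)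
  SizeT≤k*[1+k]^[k-1] _ !xs nodes = begin
    _                                       ≤⟨ Unique-All⇒length≤ (≡-dec Fin._≟_) (λ _ _ α≡β → α≡β) node∈ !xs nodes ⟩
    length (cartesianProductWith _∷_ indices tails)
                                            ≡⟨ length-cartesianProductWith _∷_ indices tails ⟩
    length indices * length tails   ≡⟨ cong (_* length tails) (length-allFin k) ⟩
    k * length tails                ≤⟨ *-monoʳ-≤ k (length-listsUpTo≤ indices (pred k)) ⟩
    k * suc (length indices) ^ pred k       ≡⟨ cong (λ m → k * suc m ^ pred k) (length-allFin k) ⟩
    k * suc k ^ pred k                      ∎
    where
    open ≤-Reasoning
    indices = allFin k
    tails = listsUpTo indices (pred k)
    node∈ : ∀ {α} → IsNode B α → α ∈ cartesianProductWith _∷_ indices tails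
    node∈ {[]}    (α≢[] , _)    = contradiction refl α≢[]
    node∈ {i ∷ α} (_    , valid) = ∈-cartesianProductWith⁺ _∷_ (∈-allFin i)
      (∈-listsUpTo indices (pred-mono-≤ |i∷α|≤k) (All.tabulate (λ {j} _ → ∈-allFin j)))
      where
      |i∷α|≤k : length (i ∷ α) ≤ k
      |i∷α|≤k = subst (_≤ k) (length-reverse (i ∷ α)) (ValidRev⇒length≤k _ valid)

  nodeCode : List (Fin k) → List ℕ
  nodeCode α = length α ∷ tabulate (coverStep (reverse α))

  nodeCode-injective : ∀ {α β} → IsNode B α → IsNode B β → nodeCode α ≡ nodeCode β → α ≡ β
  nodeCode-injective {α} {β} (_ , valid-α) (_ , valid-β) codes≡ =
    reverse-injective (coverStep-injective valid-α valid-β |rα|≡|rβ| (tabulate-injective steps≡))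
    where
    |α|≡|β| = proj₁ (∷-injective codes≡)
    steps≡ = proj₂ (∷-injective codes≡)
    |rα|≡|rβ| : length (reverse α) ≡ length (reverse β)
    |rα|≡|rβ| = trans (length-reverse α) (trans |α|≡|β| (sym (length-reverse β)))

  SizeT≤[2+n]^[1+n] : SizeT≤ B ((2 + n) ^ suc n)
  SizeT≤[2+n]^[1+n] _ !xs nodes = begin
    _                                      ≤⟨ Unique-All⇒length≤ (≡-dec _≟_) nodeCode-injective code∈ !xs nodes ⟩
    length (listsUpTo steps (suc n))       ≤⟨ length-listsUpTo≤ steps (suc n) ⟩
    suc (length steps) ^ suc n             ≡⟨ cong (λ m → suc m ^ suc n) (length-upTo (suc n)) ⟩
    (2 + n) ^ suc n                        ∎
    where
    open ≤-Reasoning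
    steps = upTo (suc n)
    code∈ : ∀ {α} → IsNode B α → nodeCode α ∈ listsUpTo steps (suc n)
    code∈ {α} (_ , valid) = ∈-listsUpTo steps (s≤s (≤-reflexive (length-tabulate _)))
      (∈-upTo⁺ (s≤s |α|≤n) ∷ tabulate⁺ (λ q → ∈-upTo⁺ (s≤s (≤-trans (coverStep≤length (reverse α) q) |rα|≤n))))
      where
      |rα|≤n : length (reverse α) ≤ n
      |rα|≤n = ValidRev⇒length≤n (reverse α) valid
      |α|≤n : length α ≤ n
      |α|≤n = subst (_≤ n) (length-reverse α) |rα|≤n

H≤2^[2*[k*lgk]] : ∀ n k → H≤ n k (2 ^ (2 * (k * lg k)))
H≤2^[2*[k*lgk]] n k B _ xs !xs nodes =
  ≤-trans (SizeT≤k*[1+k]^[k-1] B xs !xs nodes) (k*[1+k]^[k-1]≤2^[2*[k*lgk]] k)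

H≤2^[3*[n*lgn]] : ∀ {n} k → 2 ≤ n → H≤ n k (2 ^ (3 * (n * lg n)))
H≤2^[3*[n*lgn]] k 2≤n B _ xs !xs nodes =
  ≤-trans (SizeT≤[2+n]^[1+n] B xs !xs nodes) ([2+n]^[1+n]≤2^[3*[n*lgn]] 2≤n)

-- Both bounds hold for all n and k.
mainTheorem5 :
    (∀ (c : ℕ) → ∃[ C ] ∃[ N ] ∀ (n k : ℕ) → N ≤ n → k ≤ c * n →
        H≤ n k (2 ^ (C * (k * lg k))))
    ×
    (∀ (f : ℕ → ℕ) → (∀ (c : ℕ) → ∃[ M ] ∀ (n : ℕ) → M ≤ n → c * n ≤ f n) →
        ∃[ C ] ∃[ N ] ∀ (n : ℕ) → N ≤ n → H≤ n (f n) (2 ^ (C * (n * lg n))))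
mainTheorem5 =
  (λ _ → 2 , 0 , λ n k _ _ → H≤2^[2*[k*lgk]] n k) ,
  (λ f _ → 3 , 2 , λ n 2≤n → H≤2^[3*[n*lgn]] (f n) 2≤n)
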